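{- For every integer $n>1$, the path graph $P_n$ on $n$ vertices is a $G_\phi$-graph.
   Context: $\phi$ denotes Euler's totient function, $\phi^0(n)=n$ and $\phi^i(n)=\phi(\phi^{i-1}(n))$. For a set $A$ of positive integers, $A_\phi=\{\phi^k(n): n\in A,\ k\ge 0\}$, and $G_\phi(A)$ is the simple graph with vertex set $A_\phi$ in which distinct vertices $r,s$ are adjacent iff $\phi(r)=s$ or $\phi(s)=r$. A graph $H$ is a $G_\phi$-graph if there exists a set $A$ of positive integers such that $H$ is (isomorphic to) $G_\phi(A)$. -}

module Defs where

open import Data.Nat using (ℕ; zero; suc; _+_; _<_)
open import Data.Nat.GCD using (gcd)
open import Data.Nat.Properties using (_≟_)
open import Data.List using (List; length; filter; applyUpTo)
open import Data.Fin using (Fin; toℕ)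
open import Data.Product using (Σ; ∃; _×_; _,_)
open import Data.Sum using (_⊎_)
open import Relation.Nullary using (¬_)
open import Relation.Binary.PropositionalEquality using (_≡_; _≢_)
open import Function.Bundles using (_⇔_)
open import Function.Definitions using (Injective)

φ : ℕ → ℕ
φ n = length (filter (λ k → gcd k n ≟ 1) (applyUpTo suc n))

φ^ : ℕ → ℕ → ℕ
φ^ zero n = n
φ^ (suc i) n = φ (φ^ i n)

NatSet : Set₁
NatSet = ℕ → Set

Positive : NatSet → Set
Positive A = ∀ a → A a → 0 < a

closureφ : NatSet → NatSet
closureφ A m = Σ ℕ λ a → A a × ∃ λ k → φ^ k a ≡ m

-- adjacency in G_φ(A) (on vertices of A_φ): distinct and one is φ of the other
Gφ-adj : ℕ → ℕ → Set
Gφ-adj r s = r ≢ s × (φ r ≡ s ⊎ φ s ≡ r)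

path-adj : {n : ℕ} → Fin n → Fin n → Set
path-adj i j = suc (toℕ i) ≡ toℕ j ⊎ suc (toℕ j) ≡ toℕ i

-- G_φ(A) is isomorphic to P_n: a bijection f : Fin n → A_φ
-- (injective, landing in A_φ, surjective onto A_φ) preserving and reflecting adjacency
PathIso : (n : ℕ) → NatSet → Set
PathIso n A = Σ (Fin n → ℕ) λ f →
    Injective _≡_ _≡_ f
  × (∀ i → closureφ A (f i))
  × (∀ m → closureφ A m → ∃ λ i → f i ≡ m)
  × (∀ i j → path-adj i j ⇔ Gφ-adj (f i) (f j))

PathIsGφGraph : ℕ → Set₁
PathIsGφGraph n = Σ NatSet λ A → Positive A × PathIso n A

{-# OPTIONS --safe #-}
module Submission where

open import Defs
open import Data.Nat using (ℕ; zero; suc; _*_; _^_; _∸_; _<_; z≤n; s≤s; pred)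
open import Data.Nat.Properties
  using (_≟_; 1+n≢n; *-comm; m^n>0; ^-monoʳ-<; <-cmp; <-irrefl; ≤-pred; pred[m∸n]≡m∸[1+n]; m∸n≤m; m∸[m∸n]≡n)
open import Data.Nat.Divisibility using (_∣_; divides; ∣-trans; ∣1⇒≡1)
open import Data.Nat.GCD using (gcd; gcd-greatest)
open import Data.Nat.Coprimality using (Coprime; coprime-+; coprime-divisor; coprime⇒gcd≡1)
open import Data.List using (length; filter; applyUpTo)
open import Data.List.Properties using (filter-accept; filter-reject)
open import Data.Fin using (Fin; toℕ; fromℕ<)
open import Data.Fin.Properties using (toℕ-injective; toℕ-fromℕ<; toℕ<n)
open import Data.Product using (∃; _,_)
open import Data.Sum using (_⊎_; inj₁; inj₂; swap)
open import Data.Empty using (⊥-elim)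
open import Relation.Nullary using (¬_)
open import Relation.Unary using (Decidable)
open import Relation.Binary using (tri<; tri≈; tri>)
open import Relation.Binary.PropositionalEquality
open import Function.Base using (_∘′_)
open import Function.Bundles using (_⇔_; mk⇔)
open import Function.Definitions using (Injective)

-- Take A = {2^L}. Since φ(2^(m+1)) = 2^m and φ(1) = 1, the φ-orbit of 2^L is
-- 2^L, 2^(L-1), …, 2^0, and two of these powers are φ-related exactly when their
-- exponents differ by one, so G_φ(A) is the path on L + 1 vertices.

length-filter-applyUpTo-alternating :
  ∀ {P : ℕ → Set} (P? : Decidable P) (f : ℕ → ℕ) N →
  (∀ i → P (f (i * 2))) → (∀ i → ¬ P (f (suc (i * 2)))) →
  length (filter P? (applyUpTo f (N * 2))) ≡ N
length-filter-applyUpTo-alternating P? f zero even odd = refl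
length-filter-applyUpTo-alternating P? f (suc N) even odd
  rewrite filter-accept P? {f 0} {applyUpTo (λ x → f (suc x)) (suc (N * 2))} (even 0)
        | filter-reject P? {f 1} {applyUpTo (λ x → f (suc (suc x))) (N * 2)} (odd 0)
  = cong suc (length-filter-applyUpTo-alternating P? (λ x → f (suc (suc x))) N
               (λ i → even (suc i)) (λ i → odd (suc i)))

2∤1 : ¬ (2 ∣ 1)
2∤1 2∣1 with ∣1⇒≡1 2∣1
... | ()

coprime-odd-2 : ∀ i → Coprime (suc (i * 2)) 2
coprime-odd-2 zero (d∣1 , _) = ∣1⇒≡1 d∣1
coprime-odd-2 (suc i) = coprime-+ (coprime-odd-2 i)

coprime-^ : ∀ {k m} → Coprime k m → ∀ e → Coprime k (m ^ e)
coprime-^ k⊥m zero (_ , d∣1) = ∣1⇒≡1 d∣1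
coprime-^ {m = m} k⊥m (suc e) {d} (d∣k , d∣m*mᵉ) =
  coprime-^ k⊥m e (d∣k , coprime-divisor d⊥m d∣m*mᵉ)
  where
  d⊥m : Coprime d m
  d⊥m (c∣d , c∣m) = k⊥m (∣-trans c∣d d∣k , c∣m)

2∣2^suc : ∀ m → 2 ∣ 2 ^ suc m
2∣2^suc m = divides (2 ^ m) (*-comm 2 (2 ^ m))

-- Among 1, …, 2^(m+1) exactly the odd numbers are coprime to 2^(m+1).
φ-2^suc : ∀ m → φ (2 ^ suc m) ≡ 2 ^ m
φ-2^suc m = begin
  φ (2 ^ suc m)
    ≡⟨ cong (λ N → length (filter coprime? (applyUpTo suc N))) (*-comm 2 (2 ^ m)) ⟩
  length (filter coprime? (applyUpTo suc (2 ^ m * 2)))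
    ≡⟨ length-filter-applyUpTo-alternating coprime? suc (2 ^ m) odd-coprime even-not-coprime ⟩
  2 ^ m ∎
  where
  open ≡-Reasoning
  coprime? = λ k → gcd k (2 ^ suc m) ≟ 1
  odd-coprime : ∀ i → gcd (suc (i * 2)) (2 ^ suc m) ≡ 1
  odd-coprime i = coprime⇒gcd≡1 (coprime-^ (coprime-odd-2 i) (suc m))
  even-not-coprime : ∀ i → ¬ gcd (suc (suc (i * 2))) (2 ^ suc m) ≡ 1
  even-not-coprime i gcd≡1 =
    2∤1 (subst (2 ∣_) gcd≡1 (gcd-greatest (divides (suc i) refl) (2∣2^suc m)))

φ-2^ : ∀ m → φ (2 ^ m) ≡ 2 ^ pred m
φ-2^ zero    = refl
φ-2^ (suc m) = φ-2^suc m

φ^-2^ : ∀ L k → φ^ k (2 ^ L) ≡ 2 ^ (L ∸ k)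
φ^-2^ L zero    = refl
φ^-2^ L (suc k) = begin
  φ (φ^ k (2 ^ L))   ≡⟨ cong φ (φ^-2^ L k) ⟩
  φ (2 ^ (L ∸ k))    ≡⟨ φ-2^ (L ∸ k) ⟩
  2 ^ pred (L ∸ k)   ≡⟨ cong (2 ^_) (pred[m∸n]≡m∸[1+n] L k) ⟩
  2 ^ (L ∸ suc k)    ∎
  where open ≡-Reasoning

2^-injective : Injective _≡_ _≡_ (2 ^_)
2^-injective {a} {b} 2ᵃ≡2ᵇ with <-cmp a b
... | tri< a<b _ _ = ⊥-elim (<-irrefl 2ᵃ≡2ᵇ (^-monoʳ-< 2 (s≤s (s≤s z≤n)) a<b))
... | tri≈ _ a≡b _ = a≡b
... | tri> _ _ b<a = ⊥-elim (<-irrefl (sym 2ᵃ≡2ᵇ) (^-monoʳ-< 2 (s≤s (s≤s z≤n)) b<a))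

Gφ-adj-sym : ∀ {r s} → Gφ-adj r s → Gφ-adj s r
Gφ-adj-sym (r≢s , φ-related) = (λ s≡r → r≢s (sym s≡r)) , swap φ-related

suc≡-⇒Gφ-adj-2^ : ∀ {a b} → suc a ≡ b → Gφ-adj (2 ^ a) (2 ^ b)
suc≡-⇒Gφ-adj-2^ {a} refl =
  (λ 2ᵃ≡2ᵃ⁺¹ → 1+n≢n (sym (2^-injective {a} 2ᵃ≡2ᵃ⁺¹))) , inj₂ (φ-2^suc a)

φ-2^≡-⇒suc≡ : ∀ {a b} → 2 ^ a ≢ 2 ^ b → φ (2 ^ a) ≡ 2 ^ b → suc b ≡ a
φ-2^≡-⇒suc≡ {zero}  2⁰≢2ᵇ φ2⁰≡2ᵇ = ⊥-elim (2⁰≢2ᵇ φ2⁰≡2ᵇ)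
φ-2^≡-⇒suc≡ {suc a} _    φ2ᵃ⁺¹≡2ᵇ = cong suc (sym (2^-injective (trans (sym (φ-2^suc a)) φ2ᵃ⁺¹≡2ᵇ)))

Gφ-adj-2^⇒suc≡ : ∀ {a b} → Gφ-adj (2 ^ a) (2 ^ b) → suc a ≡ b ⊎ suc b ≡ a
Gφ-adj-2^⇒suc≡ (2ᵃ≢2ᵇ , inj₁ φ2ᵃ≡2ᵇ) = inj₂ (φ-2^≡-⇒suc≡ 2ᵃ≢2ᵇ φ2ᵃ≡2ᵇ)
Gφ-adj-2^⇒suc≡ (2ᵃ≢2ᵇ , inj₂ φ2ᵇ≡2ᵃ) = inj₁ (φ-2^≡-⇒suc≡ (λ e → 2ᵃ≢2ᵇ (sym e)) φ2ᵇ≡2ᵃ)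

PathIso-2^ : ∀ L → PathIso (suc L) (_≡ 2 ^ L)
PathIso-2^ L = vertex , injective , in-orbit , onto-orbit , adjacency
  where
  vertex : Fin (suc L) → ℕ
  vertex i = 2 ^ toℕ i

  injective : Injective _≡_ _≡_ vertex
  injective = toℕ-injective ∘′ 2^-injective

  in-orbit : ∀ i → closureφ (_≡ 2 ^ L) (vertex i)
  in-orbit i = 2 ^ L , refl , L ∸ toℕ i ,
    trans (φ^-2^ L (L ∸ toℕ i)) (cong (2 ^_) (m∸[m∸n]≡n (≤-pred (toℕ<n i))))

  onto-orbit : ∀ m → closureφ (_≡ 2 ^ L) m → ∃ λ i → vertex i ≡ m
  onto-orbit m (_ , refl , k , φᵏ2ᴸ≡m) = fromℕ< k-steps-left ,
    trans (cong (2 ^_) (toℕ-fromℕ< k-steps-left)) (trans (sym (φ^-2^ L k)) φᵏ2ᴸ≡m)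
    where k-steps-left = s≤s (m∸n≤m L k)

  adjacency : ∀ i j → path-adj i j ⇔ Gφ-adj (vertex i) (vertex j)
  adjacency i j = mk⇔ to Gφ-adj-2^⇒suc≡
    where
    to : path-adj i j → Gφ-adj (vertex i) (vertex j)
    to (inj₁ i+1≡j) = suc≡-⇒Gφ-adj-2^ i+1≡j
    to (inj₂ j+1≡i) = Gφ-adj-sym (suc≡-⇒Gφ-adj-2^ j+1≡i)

-- P₁ is realised as well; the hypothesis only serves to exclude n = 0.
theorem2p4 : (n : ℕ) → 1 < n → PathIsGφGraph n
theorem2p4 (suc L) _ = (_≡ 2 ^ L) , (λ { _ refl → m^n>0 2 L }) , PathIso-2^ L
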